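{- Every metric space $A\in\mathcal{A}^3_{\infty,0,7,8}$ on $n\ge 3$ points consists of two $2$-cliques, one on $k$ points and the other on $n-k$ points, for some $0\le k\le n-k$; that is, the point set of $A$ is the disjoint union of two $2$-cliques of sizes $k$ and $n-k$ (where a $2$-clique may be empty or a single point).
   Context: $\mathcal{A}^3_{\infty,0,7,8}$ is the class of finite metric spaces, all of whose distances between distinct points lie in $\{1,2,3\}$, in which for every three distinct points the multiset of their pairwise distances is one of $\{1,1,2\}$, $\{1,2,3\}$, $\{2,2,2\}$. A $2$-clique is a set of points any two distinct members of which are at distance $2$. -}

module Defs where

open import Data.Nat using (ℕ; _+_; _≤_)
open import Data.Fin using (Fin)
open import Data.Fin.Subset using (Subset; _∈_; ∁; ∣_∣)
open import Data.List using (List; _∷_; [])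
open import Data.List.Relation.Binary.Permutation.Propositional using (_↭_)
open import Data.Product using (_×_)
open import Data.Sum using (_⊎_)
open import Relation.Binary.PropositionalEquality using (_≡_; _≢_)
open import Relation.Nullary using (¬_)

record IsMetric {n : ℕ} (d : Fin n → Fin n → ℕ) : Set where
  field
    dist-refl : ∀ x → d x x ≡ 0
    dist-pos  : ∀ x y → x ≢ y → ¬ (d x y ≡ 0)
    dist-sym  : ∀ x y → d x y ≡ d y x
    dist-tri  : ∀ x y z → d x z ≤ d x y + d y z

AllowedTriangle : ℕ → ℕ → ℕ → Set
AllowedTriangle a b c =
  ((a ∷ b ∷ c ∷ []) ↭ (1 ∷ 1 ∷ 2 ∷ []))
  ⊎ ((a ∷ b ∷ c ∷ []) ↭ (1 ∷ 2 ∷ 3 ∷ []))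
  ⊎ ((a ∷ b ∷ c ∷ []) ↭ (2 ∷ 2 ∷ 2 ∷ []))

record InA3-∞-0-7-8 {n : ℕ} (d : Fin n → Fin n → ℕ) : Set where
  field
    metric     : IsMetric d
    distances  : ∀ x y → x ≢ y → (d x y ≡ 1) ⊎ (d x y ≡ 2) ⊎ (d x y ≡ 3)
    triangles  : ∀ x y z → x ≢ y → y ≢ z → x ≢ z →
                 AllowedTriangle (d x y) (d y z) (d x z)

Is2Clique : {n : ℕ} → (Fin n → Fin n → ℕ) → Subset n → Set
Is2Clique d S = ∀ x y → x ∈ S → y ∈ S → x ≢ y → d x y ≡ 2

-- Distance 2 is the only even distance, and every allowed triangle has even perimeter
-- (4 or 6). So if d(p,x) and d(p,y) have the same parity, the triangle p x y forces
-- d(x,y) to be even, i.e. equal to 2. Splitting the points by the parity of their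
-- distance to a fixed point p therefore gives two 2-cliques; take the smaller one first.
module Submission where

open import Defs
open import Data.Bool using (Bool; true; false; not)
open import Data.Bool.Properties using (not-injective)
open import Data.Fin using (Fin; _≟_)
import Data.Fin as Fin
open import Data.Fin.Subset using (Subset; ∁; ∣_∣; _∈_)
open import Data.Fin.Subset.Properties
  using (x∈∁p⇒x∉p; x∉∁p⇒x∈p; ∣∁p∣≡n∸∣p∣; ∣p∣≤n)
open import Data.List using (_∷_; [])
open import Data.Nat using (ℕ; suc; _+_; _≤_; _∸_; parity)
open import Data.Nat.ListAction.Properties using (sum-↭)
open import Data.Nat.Properties using (_≤?_; ≰⇒>; <⇒≤; m∸[m∸n]≡n; +-identityʳ)
open import Data.Parity.Base using (Parity; 0ℙ; 1ℙ) renaming (_+_ to _⊕_)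
open import Data.Parity.Properties using (+-homo-+)
open import Data.Product using (Σ; _×_; _,_)
open import Data.Sum using (_⊎_; inj₁; inj₂)
open import Data.Vec using (lookup; tabulate)
open import Data.Vec.Properties using ([]=⇒lookup; lookup∘tabulate; lookup-map)
open import Relation.Binary.PropositionalEquality
  using (_≡_; _≢_; refl; sym; trans; cong; module ≡-Reasoning)
open import Relation.Nullary using (yes; no)

parity-sum₃ : ∀ a b c → parity (a + (b + (c + 0))) ≡ parity a ⊕ (parity b ⊕ parity c)
parity-sum₃ a b c = begin
  parity (a + (b + (c + 0)))         ≡⟨ cong (λ k → parity (a + (b + k))) (+-identityʳ c) ⟩
  parity (a + (b + c))               ≡⟨ +-homo-+ a (b + c) ⟩
  parity a ⊕ parity (b + c)          ≡⟨ cong (parity a ⊕_) (+-homo-+ b c) ⟩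
  parity a ⊕ (parity b ⊕ parity c)   ∎
  where open ≡-Reasoning

allowedTriangle-even-perimeter : ∀ {a b c} → AllowedTriangle a b c →
                                 parity a ⊕ (parity b ⊕ parity c) ≡ 0ℙ
allowedTriangle-even-perimeter {a} {b} {c} t = trans (sym (parity-sum₃ a b c)) (even t)
  where
  even : AllowedTriangle a b c → parity (a + (b + (c + 0))) ≡ 0ℙ
  even (inj₁ p)        = cong parity (sum-↭ p)
  even (inj₂ (inj₁ p)) = cong parity (sum-↭ p)
  even (inj₂ (inj₂ p)) = cong parity (sum-↭ p)

p⊕[q⊕p]≡q : ∀ p q → p ⊕ (q ⊕ p) ≡ q
p⊕[q⊕p]≡q 0ℙ 0ℙ = refl
p⊕[q⊕p]≡q 0ℙ 1ℙ = refl
p⊕[q⊕p]≡q 1ℙ 0ℙ = refl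
p⊕[q⊕p]≡q 1ℙ 1ℙ = refl

middle-even : ∀ {p q r} → p ≡ r → p ⊕ (q ⊕ r) ≡ 0ℙ → q ≡ 0ℙ
middle-even {p} {q} refl even = trans (sym (p⊕[q⊕p]≡q p q)) even

even-distance≡2 : ∀ {a} → (a ≡ 1) ⊎ (a ≡ 2) ⊎ (a ≡ 3) → parity a ≡ 0ℙ → a ≡ 2
even-distance≡2 (inj₁ refl)        ()
even-distance≡2 (inj₂ (inj₁ refl)) _ = refl
even-distance≡2 (inj₂ (inj₂ refl)) ()

module _ {n : ℕ} (d : Fin n → Fin n → ℕ) where

  2Cliques-of-colouring : (c : Fin n → Bool) →
    (∀ x y → x ≢ y → c x ≡ c y → d x y ≡ 2) →
    Is2Clique d (tabulate c) × Is2Clique d (∁ (tabulate c))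
  2Cliques-of-colouring c same⇒2 =
    (λ x y x∈ y∈ x≢y → same⇒2 x y x≢y (trans (∈⇒true x∈) (sym (∈⇒true y∈)))) ,
    (λ x y x∈ y∈ x≢y → same⇒2 x y x≢y (trans (∈∁⇒false x∈) (sym (∈∁⇒false y∈))))
    where
    ∈⇒true : ∀ {x} → x ∈ tabulate c → c x ≡ true
    ∈⇒true {x} x∈ = trans (sym (lookup∘tabulate c x)) ([]=⇒lookup x∈)

    ∈∁⇒false : ∀ {x} → x ∈ ∁ (tabulate c) → c x ≡ false
    ∈∁⇒false {x} x∈ = not-injective (begin
      not (c x)                      ≡⟨ cong not (sym (lookup∘tabulate c x)) ⟩
      not (lookup (tabulate c) x)    ≡⟨ sym (lookup-map x not (tabulate c)) ⟩
      lookup (∁ (tabulate c)) x      ≡⟨ []=⇒lookup x∈ ⟩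
      not false                      ∎)
      where open ≡-Reasoning

  Is2Clique-∁∁ : {S : Subset n} → Is2Clique d S → Is2Clique d (∁ (∁ S))
  Is2Clique-∁∁ clique x y x∈ y∈ =
    clique x y (x∉∁p⇒x∈p (x∈∁p⇒x∉p x∈)) (x∉∁p⇒x∈p (x∈∁p⇒x∉p y∈))

smaller-half : ∀ {n} (S : Subset n) → ∣ S ∣ ≤ n ∸ ∣ S ∣ ⊎ ∣ ∁ S ∣ ≤ n ∸ ∣ ∁ S ∣
smaller-half {n} S with ∣ S ∣ ≤? n ∸ ∣ S ∣
... | yes small = inj₁ small
... | no large
  rewrite ∣∁p∣≡n∸∣p∣ S | m∸[m∸n]≡n (∣p∣≤n S) = inj₂ (<⇒≤ (≰⇒> large))

isEven : Parity → Bool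
isEven 0ℙ = true
isEven 1ℙ = false

isEven-injective : ∀ {p q} → isEven p ≡ isEven q → p ≡ q
isEven-injective {0ℙ} {0ℙ} _ = refl
isEven-injective {1ℙ} {1ℙ} _ = refl

evenFrom : ∀ {n} → (Fin n → Fin n → ℕ) → Fin n → Subset n
evenFrom d p = tabulate (λ x → isEven (parity (d p x)))

module _ {n : ℕ} {d : Fin n → Fin n → ℕ} (A : InA3-∞-0-7-8 d) where
  open InA3-∞-0-7-8 A
  open IsMetric metric

  equal-distance-parity⇒2 : ∀ p x y → x ≢ y → parity (d p x) ≡ parity (d p y) → d x y ≡ 2
  equal-distance-parity⇒2 p x y x≢y same with p ≟ x | p ≟ y
  ... | yes refl | _ =
    even-distance≡2 (distances x y x≢y) (trans (sym same) (cong parity (dist-refl x)))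
  ... | no _ | yes refl = trans (dist-sym x y)
    (even-distance≡2 (distances y x (λ y≡x → x≢y (sym y≡x)))
                     (trans same (cong parity (dist-refl y))))
  ... | no p≢x | no p≢y = even-distance≡2 (distances x y x≢y)
    (middle-even same (allowedTriangle-even-perimeter (triangles p x y p≢x x≢y p≢y)))

  evenFrom-2Cliques : (p : Fin n) → Is2Clique d (evenFrom d p) × Is2Clique d (∁ (evenFrom d p))
  evenFrom-2Cliques p = 2Cliques-of-colouring d (λ x → isEven (parity (d p x)))
    (λ x y x≢y same → equal-distance-parity⇒2 p x y x≢y (isEven-injective same))

corollary2p7 : (n : ℕ) → 3 ≤ n → (d : Fin n → Fin n → ℕ) → InA3-∞-0-7-8 d →
    Σ (Subset n) (λ S →
      Is2Clique d S × Is2Clique d (∁ S) × ∣ S ∣ ≤ n ∸ ∣ S ∣)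
corollary2p7 (suc m) _ d A
  with evenFrom-2Cliques A Fin.zero | smaller-half (evenFrom d Fin.zero)
... | S-clique , ∁S-clique | inj₁ small = _ , S-clique , ∁S-clique , small
... | S-clique , ∁S-clique | inj₂ small = _ , ∁S-clique , Is2Clique-∁∁ d S-clique , small
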